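{- If $G$ is a graph with $\mathrm{diam}(G)\geq5$ and $H$ is any graph, then $\gamma(G\diamond H)\leq\gamma(G)$.
   Context: All graphs are finite, simple and undirected; $\mathrm{diam}(G)$ is the maximum distance between two vertices ($\infty$ if $G$ is disconnected). The modular product $G\diamond H$ has vertex set $V(G)\times V(H)$, and two distinct vertices $(g,h)$ and $(g',h')$ are adjacent iff either ($g=g'$ and $hh'\in E(H)$), or ($gg'\in E(G)$ and $h=h'$), or ($gg'\in E(G)$ and $hh'\in E(H)$), or ($g\neq g'$, $h\neq h'$, $gg'\notin E(G)$ and $hh'\notin E(H)$). $\gamma$ is the domination number. -}

module Defs where

open import Data.Nat using (ℕ; zero; suc; _*_; _≤_)
open import Data.Bool using (Bool; true; false; not; _∧_; _∨_)
open import Data.Fin using (Fin; remQuot; _≟_)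
open import Data.Fin.Subset using (Subset; _∈_; ∣_∣)
open import Data.Product using (Σ; ∃; _×_; _,_; proj₁; proj₂)
open import Data.Sum using (_⊎_)
open import Relation.Nullary using (¬_; does)
open import Relation.Binary.PropositionalEquality using (_≡_; refl)
import Relation.Binary.PropositionalEquality as ≡
open import Relation.Nullary using (yes; no)
open import Data.Empty using (⊥-elim)
import Data.Unit

record Graph (n : ℕ) : Set where
  field
    adj   : Fin n → Fin n → Bool
    sym   : ∀ u v → adj u v ≡ adj v u
    irref : ∀ u → adj u u ≡ false
open Graph public

_==_ : ∀ {n} → Fin n → Fin n → Bool
i == j = does (i ≟ j)

modAdj : ∀ {m n} → Graph m → Graph n → Fin m → Fin n → Fin m → Fin n → Bool
modAdj G H g h g' h' =
     ((g == g') ∧ adj H h h')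
  ∨ ((adj G g g') ∧ (h == h'))
  ∨ ((adj G g g') ∧ adj H h h')
  ∨ (not (g == g') ∧ not (h == h') ∧ not (adj G g g') ∧ not (adj H h h'))

==-sym : ∀ {n} (i j : Fin n) → (i == j) ≡ (j == i)
==-sym i j with i ≟ j | j ≟ i
... | yes _ | yes _ = refl
... | no _  | no _  = refl
... | yes p | no q  = ⊥-elim (q (≡.sym p))
... | no p  | yes q = ⊥-elim (p (≡.sym q))

==-refl : ∀ {n} (i : Fin n) → (i == i) ≡ true
==-refl i with i ≟ i
... | yes _ = refl
... | no p  = ⊥-elim (p refl)

modAdj-sym : ∀ {m n} (G : Graph m) (H : Graph n) g h g' h' →
             modAdj G H g h g' h' ≡ modAdj G H g' h' g h
modAdj-sym G H g h g' h'
  rewrite ==-sym g g' | ==-sym h h' | sym G g g' | sym H h h' = refl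

-- The modular product G ⋄ H, with vertex set Fin (m * n) ≅ Fin m × Fin n
-- (via the bijection remQuot). Two vertices are adjacent iff they are
-- distinct and satisfy the modular-product rule.
_⋄_ : ∀ {m n} → Graph m → Graph n → Graph (m * n)
_⋄_ {m} {n} G H = record { adj = A ; sym = S ; irref = I }
  where
  A : Fin (m * n) → Fin (m * n) → Bool
  A x y = not (x == y) ∧ modAdj G H (proj₁ (remQuot {m} n x)) (proj₂ (remQuot {m} n x))
                                     (proj₁ (remQuot {m} n y)) (proj₂ (remQuot {m} n y))
  S : ∀ u v → A u v ≡ A v u
  S u v rewrite ==-sym u v | modAdj-sym G H (proj₁ (remQuot {m} n u)) (proj₂ (remQuot {m} n u))
                                        (proj₁ (remQuot {m} n v)) (proj₂ (remQuot {m} n v)) = refl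
  I : ∀ u → A u u ≡ false
  I u rewrite ==-refl u = refl

data Within {n} (G : Graph n) : ℕ → Fin n → Fin n → Set where
  here : ∀ {k u} → Within G k u u
  step : ∀ {k u w v} → adj G u w ≡ true → Within G k w v → Within G (suc k) u v

-- diam(G) ≥ d  (with diam = ∞ for disconnected graphs):
-- some pair of vertices has distance ≥ d, i.e. not ≤ d - 1.
DiamAtLeast : ∀ {n} → Graph n → ℕ → Set
DiamAtLeast G zero    = Data.Unit.⊤
DiamAtLeast G (suc d) = ∃ λ u → ∃ λ v → ¬ Within G d u v

Dominating : ∀ {n} → Graph n → Subset n → Set
Dominating {n} G D = ∀ v → v ∈ D ⊎ (∃ λ u → u ∈ D × adj G u v ≡ true)

IsDomNumber : ∀ {n} → Graph n → ℕ → Set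
IsDomNumber {n} G k =
  (∃ λ D → Dominating G D × ∣ D ∣ ≡ k) × (∀ D → Dominating G D → k ≤ ∣ D ∣)

{-# OPTIONS --safe #-}
module Submission where

-- Fix a vertex h₀ of H and a dominating set D of G; then D × {h₀} dominates G ⋄ H.
-- A vertex (g, h₀) is dominated inside its layer, and if h ~ h₀ then (g, h) is
-- dominated by (d, h₀) for any d ∈ D with d = g or d ~ g. If h ≁ h₀ one needs
-- d ∈ D with d ≠ g and d ≁ g; it exists because D ⊆ N[g] would put every vertex
-- within distance 2 of g, so that diam(G) ≤ 4.

open import Defs
open import Data.Nat using (ℕ; zero; suc; _+_; _*_; _≤_; z≤n; s≤s)
open import Data.Nat.Properties using (m≤n+m; *-identityʳ; ≤-trans; module ≤-Reasoning)
open import Data.Bool using (true; false; _∧_)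
import Data.Bool.Properties as Bool
open import Data.Fin using (Fin; zero; suc; combine; remQuot; _≟_)
open import Data.Fin.Properties using (remQuot-combine; combine-injective; combine-surjective; any?)
open import Data.Fin.Subset using (Subset; _∈_; ∣_∣; ⁅_⁆; ⊥)
open import Data.Fin.Subset.Properties using (x∈⁅x⁆; ∣⁅x⁆∣≡1; ∣⊥∣≡0; _∈?_)
open import Data.Vec using ([]; _∷_; _++_; lookup)
open import Data.Vec.Properties using (lookup-++ˡ; lookup-++ʳ; lookup-replicate; []=⇒lookup; lookup⇒[]=)
open import Data.Product using (∃; _×_; _,_; proj₁; proj₂)
open import Data.Sum using (_⊎_; inj₁; inj₂)
open import Function using (_∘_; case_of_)
open import Relation.Nullary using (¬_; yes; no; ¬?; contradiction)
open import Relation.Nullary.Decidable using (Dec; _×-dec_; _⊎-dec_; dec-false; decidable-stable)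
open import Relation.Binary.PropositionalEquality using (_≡_; _≢_; refl; cong; cong₂; trans; subst; subst₂; module ≡-Reasoning)
import Relation.Binary.PropositionalEquality as ≡

private
  variable
    m n k l : ℕ

Near : Graph n → Fin n → Fin n → Set
Near G u v = u ≡ v ⊎ adj G u v ≡ true

Near? : (G : Graph n) (u v : Fin n) → Dec (Near G u v)
Near? G u v = (u ≟ v) ⊎-dec (adj G u v Bool.≟ true)

Near-sym : (G : Graph n) {u v : Fin n} → Near G u v → Near G v u
Near-sym G         (inj₁ refl) = inj₁ refl
Near-sym G {u} {v} (inj₂ e)    = inj₂ (trans (sym G v u) e)

adj⇒≢ : (G : Graph n) {u v : Fin n} → adj G u v ≡ true → u ≢ v
adj⇒≢ G {u} e refl = contradiction (trans (≡.sym e) (irref G u)) λ ()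

module _ {G : Graph n} where

  Within-mono : k ≤ l → ∀ {u v} → Within G k u v → Within G l u v
  Within-mono _       here       = here
  Within-mono (s≤s p) (step e w) = step e (Within-mono p w)

  Within-++ : ∀ {k l u w v} → Within G k u w → Within G l w v → Within G (k + l) u v
  Within-++ {k} {l} here       q = Within-mono (m≤n+m l k) q
  Within-++         (step e p) q = step e (Within-++ p q)

  Near⇒Within₁ : ∀ {u v} → Near G u v → Within G 1 u v
  Near⇒Within₁ (inj₁ refl) = here
  Near⇒Within₁ (inj₂ e)    = step e here

  Near∘Near⇒Within₂ : ∀ {u w v} → Near G u w → Near G w v → Within G 2 u v
  Near∘Near⇒Within₂ p q = Within-++ (Near⇒Within₁ p) (Near⇒Within₁ q)

DominatedBy : Graph n → Subset n → Fin n → Set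
DominatedBy G D v = v ∈ D ⊎ ∃ λ u → u ∈ D × adj G u v ≡ true

module Dominators {G : Graph n} {D : Subset n} (dom : Dominating G D) where

  dominator : ∀ v → ∃ λ d → d ∈ D × Near G d v
  dominator v with dom v
  ... | inj₁ v∈D             = v , v∈D , inj₁ refl
  ... | inj₂ (d , d∈D , d~v) = d , d∈D , inj₂ d~v

  Dominating-⊆Near⇒Within₄ : ∀ {g} → (∀ d → d ∈ D → Near G d g) → ∀ u v → Within G 4 u v
  Dominating-⊆Near⇒Within₄ {g} near u v
    with du , du∈D , du~u ← dominator u
       | dv , dv∈D , dv~v ← dominator v
    = Within-++ (Near∘Near⇒Within₂ (Near-sym G du~u) (near du du∈D))
                (Near∘Near⇒Within₂ (Near-sym G (near dv dv∈D)) dv~v)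

  ∃-member-¬Near : DiamAtLeast G 5 → ∀ g → ∃ λ d → d ∈ D × ¬ Near G d g
  ∃-member-¬Near (u , v , u↮v) g with any? (λ d → (d ∈? D) ×-dec ¬? (Near? G d g))
  ... | yes far = far
  ... | no ¬far = contradiction (Dominating-⊆Near⇒Within₄ near u v) u↮v
    where
    near : ∀ d → d ∈ D → Near G d g
    near d d∈D = decidable-stable (Near? G d g) λ ¬near → ¬far (d , d∈D , ¬near)

infixr 7 _⊗_

_⊗_ : Subset m → Subset n → Subset (m * n)
[]          ⊗ q = []
(true  ∷ p) ⊗ q = q ++ p ⊗ q
(false ∷ p) ⊗ q = ⊥ ++ p ⊗ q

lookup-⊗ : (p : Subset m) (q : Subset n) (i : Fin m) (j : Fin n) →
           lookup (p ⊗ q) (combine i j) ≡ lookup p i ∧ lookup q j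
lookup-⊗ (true  ∷ p) q zero j = lookup-++ˡ q (p ⊗ q) j
lookup-⊗ {n = n} (false ∷ p) q zero j = trans (lookup-++ˡ (⊥ {n}) (p ⊗ q) j) (lookup-replicate j false)
lookup-⊗ (true  ∷ p) q (suc i) j = trans (lookup-++ʳ q (p ⊗ q) (combine i j)) (lookup-⊗ p q i j)
lookup-⊗ {n = n} (false ∷ p) q (suc i) j = trans (lookup-++ʳ (⊥ {n}) (p ⊗ q) (combine i j)) (lookup-⊗ p q i j)

combine∈⊗ : {p : Subset m} {q : Subset n} {i : Fin m} {j : Fin n} →
            i ∈ p → j ∈ q → combine i j ∈ p ⊗ q
combine∈⊗ {p = p} {q} {i} {j} i∈p j∈q = lookup⇒[]= (combine i j) (p ⊗ q) (begin
  lookup (p ⊗ q) (combine i j) ≡⟨ lookup-⊗ p q i j ⟩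
  lookup p i ∧ lookup q j      ≡⟨ cong₂ _∧_ ([]=⇒lookup i∈p) ([]=⇒lookup j∈q) ⟩
  true                         ∎)
  where open ≡-Reasoning

∣p++q∣≡∣p∣+∣q∣ : (p : Subset m) (q : Subset n) → ∣ p ++ q ∣ ≡ ∣ p ∣ + ∣ q ∣
∣p++q∣≡∣p∣+∣q∣ []          q = refl
∣p++q∣≡∣p∣+∣q∣ (true  ∷ p) q = cong suc (∣p++q∣≡∣p∣+∣q∣ p q)
∣p++q∣≡∣p∣+∣q∣ (false ∷ p) q = ∣p++q∣≡∣p∣+∣q∣ p q

∣p⊗q∣≡∣p∣*∣q∣ : (p : Subset m) (q : Subset n) → ∣ p ⊗ q ∣ ≡ ∣ p ∣ * ∣ q ∣
∣p⊗q∣≡∣p∣*∣q∣ []          q = refl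
∣p⊗q∣≡∣p∣*∣q∣ (true  ∷ p) q =
  trans (∣p++q∣≡∣p∣+∣q∣ q (p ⊗ q)) (cong (∣ q ∣ +_) (∣p⊗q∣≡∣p∣*∣q∣ p q))
∣p⊗q∣≡∣p∣*∣q∣ {n = n} (false ∷ p) q =
  trans (∣p++q∣≡∣p∣+∣q∣ (⊥ {n}) (p ⊗ q)) (cong₂ _+_ (∣⊥∣≡0 n) (∣p⊗q∣≡∣p∣*∣q∣ p q))

module _ {m n} (G : Graph m) (H : Graph n) where

  modAdj-irrefl : ∀ g h → modAdj G H g h g h ≡ false
  modAdj-irrefl g h rewrite ==-refl g | ==-refl h | irref G g | irref H h = refl

  modAdj-≡-adj : ∀ g {h h'} → adj H h h' ≡ true → modAdj G H g h g h' ≡ true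
  modAdj-≡-adj g e rewrite ==-refl g | e = refl

  modAdj-adj-≡ : ∀ {g g'} h → adj G g g' ≡ true → modAdj G H g h g' h ≡ true
  modAdj-adj-≡ {g} {g'} h e rewrite dec-false (g ≟ g') (adj⇒≢ G e) | e | ==-refl h = refl

  modAdj-adj-adj : ∀ {g g' h h'} → adj G g g' ≡ true → adj H h h' ≡ true → modAdj G H g h g' h' ≡ true
  modAdj-adj-adj {g} {g'} {h} {h'} eG eH
    rewrite dec-false (g ≟ g') (adj⇒≢ G eG) | dec-false (h ≟ h') (adj⇒≢ H eH) | eG | eH = refl

  modAdj-nonadj-nonadj : ∀ {g g' h h'} → g ≢ g' → h ≢ h' → adj G g g' ≡ false → adj H h h' ≡ false →
                         modAdj G H g h g' h' ≡ true
  modAdj-nonadj-nonadj {g} {g'} {h} {h'} g≢g' h≢h' eG eH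
    rewrite dec-false (g ≟ g') g≢g' | dec-false (h ≟ h') h≢h' | eG | eH = refl

  ⋄-adj-remQuot : ∀ x y → x ≢ y →
                  modAdj G H (proj₁ (remQuot {m} n x)) (proj₂ (remQuot {m} n x))
                             (proj₁ (remQuot {m} n y)) (proj₂ (remQuot {m} n y)) ≡ true →
                  adj (G ⋄ H) x y ≡ true
  ⋄-adj-remQuot x y x≢y e rewrite dec-false (x ≟ y) x≢y = e

  ⋄-adj : ∀ {g g' h h'} → modAdj G H g h g' h' ≡ true → adj (G ⋄ H) (combine g h) (combine g' h') ≡ true
  ⋄-adj {g} {g'} {h} {h'} e = ⋄-adj-remQuot (combine g h) (combine g' h') distinct
    (subst₂ (λ x y → modAdj G H (proj₁ x) (proj₂ x) (proj₁ y) (proj₂ y) ≡ true)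
            (≡.sym (remQuot-combine g h)) (≡.sym (remQuot-combine g' h')) e)
    where
    distinct : combine g h ≢ combine g' h'
    distinct c≡c' with refl , refl ← combine-injective g h g' h' c≡c' =
      contradiction (trans (≡.sym e) (modAdj-irrefl g h)) λ ()

⊗⁅⁆-dominating : ∀ {m n} {G : Graph m} (H : Graph n) {D : Subset m} →
                 Dominating G D → DiamAtLeast G 5 → ∀ h₀ → Dominating (G ⋄ H) (D ⊗ ⁅ h₀ ⁆)
⊗⁅⁆-dominating {m} {n} {G} H {D} dom diam h₀ x
  with g , h , refl ← combine-surjective {m} {n} x = dominated g h
  where
  open Dominators {G = G} {D} dom

  in-layer : ∀ {d} → d ∈ D → combine d h₀ ∈ D ⊗ ⁅ h₀ ⁆
  in-layer d∈D = combine∈⊗ d∈D (x∈⁅x⁆ h₀)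

  dominated : ∀ g h → DominatedBy (G ⋄ H) (D ⊗ ⁅ h₀ ⁆) (combine g h)
  dominated g h with h₀ ≟ h
  ... | yes refl with dominator g
  ...   | _ , g∈D , inj₁ refl = inj₁ (in-layer g∈D)
  ...   | d , d∈D , inj₂ d~g  = inj₂ (combine d h₀ , in-layer d∈D , ⋄-adj G H (modAdj-adj-≡ G H h₀ d~g))
  dominated g h | no h₀≢h with adj H h₀ h in h₀~h
  ... | true with dominator g
  ...   | _ , g∈D , inj₁ refl = inj₂ (combine g h₀ , in-layer g∈D , ⋄-adj G H (modAdj-≡-adj G H g h₀~h))
  ...   | d , d∈D , inj₂ d~g  = inj₂ (combine d h₀ , in-layer d∈D , ⋄-adj G H (modAdj-adj-adj G H d~g h₀~h))
  dominated g h | no h₀≢h | false with d , d∈D , d≁g ← ∃-member-¬Near diam g =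
    inj₂ (combine d h₀ , in-layer d∈D ,
          ⋄-adj G H (modAdj-nonadj-nonadj G H (d≁g ∘ inj₁) h₀≢h (Bool.¬-not (d≁g ∘ inj₂)) h₀~h))

corollary18 : ∀ {m n} (G : Graph m) (H : Graph n) → DiamAtLeast G 5 →
              ∀ (k k' : ℕ) → IsDomNumber G k → IsDomNumber (G ⋄ H) k' → k' ≤ k
corollary18 {m} {zero} G H _ k k' _ (_ , minimal) =
  ≤-trans (subst (k' ≤_) (∣⊥∣≡0 (m * 0)) (minimal ⊥ λ x → case proj₂ (remQuot {m} 0 x) of λ ())) z≤n
corollary18 {m} {suc n} G H diam k k' ((D , dom , refl) , _) (_ , minimal) = begin
  k'                   ≤⟨ minimal (D ⊗ ⁅ h₀ ⁆) (⊗⁅⁆-dominating H dom diam h₀) ⟩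
  ∣ D ⊗ ⁅ h₀ ⁆ ∣       ≡⟨ ∣p⊗q∣≡∣p∣*∣q∣ D ⁅ h₀ ⁆ ⟩
  ∣ D ∣ * ∣ ⁅ h₀ ⁆ ∣   ≡⟨ cong (∣ D ∣ *_) (∣⁅x⁆∣≡1 h₀) ⟩
  ∣ D ∣ * 1            ≡⟨ *-identityʳ ∣ D ∣ ⟩
  ∣ D ∣                ∎
  where
  open ≤-Reasoning

  h₀ : Fin (suc n)
  h₀ = zero
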